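{- Let $(\mathcal{C},\mathrm{Tm})$ be a ucwf, and make $s$ into a functor $\mathcal{C}\to\mathcal{C}$ by $s(\gamma)=\langle\gamma\circ\mathrm{p}_m,\mathrm{q}_m\rangle : s(m)\to s(n)$ for $\gamma:m\to n$. Then: (1) for any $\lambda\beta\eta$-structure $(\lambda,\mathrm{ap})$ on $(\mathcal{C},\mathrm{Tm})$, the family $(\lambda_n)_n$ is a natural isomorphism of presheaves $\mathrm{Tm}(s(-))\cong\mathrm{Tm}(-)$; and (2) given any natural isomorphism $\lambda:\mathrm{Tm}(s(-))\cong\mathrm{Tm}(-)$, there is a unique $\lambda\beta\eta$-structure on $(\mathcal{C},\mathrm{Tm})$ whose abstraction operation is $\lambda$.
   Context: A unityped category with families (ucwf) consists of: a category $\mathcal{C}$ with a chosen terminal object $0$; a presheaf $\mathrm{Tm}:\mathcal{C}^{\mathrm{op}}\to\mathrm{Set}$ (for $\gamma:n\to m$ and $a\in\mathrm{Tm}(m)$ write $a[\gamma]\in\mathrm{Tm}(n)$); and for each object $n$ a chosen object $s(n)$, morphism $\mathrm{p}_n:s(n)\to n$ and term $\mathrm{q}_n\in\mathrm{Tm}(s(n))$ such that for all $\gamma:m\to n$ and $a\in\mathrm{Tm}(m)$ there is a unique $\langle\gamma,a\rangle:m\to s(n)$ with $\mathrm{p}_n\circ\langle\gamma,a\rangle=\gamma$ and $\mathrm{q}_n[\langle\gamma,a\rangle]=a$. A $\lambda\beta\eta$-structure on a ucwf consists of operations $\lambda_n:\mathrm{Tm}(s(n))\to\mathrm{Tm}(n)$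 and $\mathrm{ap}_n:\mathrm{Tm}(n)\times\mathrm{Tm}(n)\to\mathrm{Tm}(n)$ for all objects $n$, satisfying, for $\gamma:m\to n$, $b\in\mathrm{Tm}(s(n))$, $c,a\in\mathrm{Tm}(n)$: $\lambda_n(b)[\gamma]=\lambda_m(b[\langle\gamma\circ\mathrm{p}_m,\mathrm{q}_m\rangle])$; $\mathrm{ap}_n(c,a)[\gamma]=\mathrm{ap}_m(c[\gamma],a[\gamma])$; $\mathrm{ap}_n(\lambda_n(b),a)=b[\langle\mathrm{id}_n,a\rangle]$ ($\beta$); $\lambda_n(\mathrm{ap}_{s(n)}(c[\mathrm{p}_n],\mathrm{q}_n))=c$ ($\eta$). -}

module Defs where

open import Level using (Level; _⊔_) renaming (suc to lsuc)
open import Relation.Binary.PropositionalEquality using (_≡_)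
open import Data.Product using (Σ; _×_)

record Ucwf (o h t : Level) : Set (lsuc (o ⊔ h ⊔ t)) where
  infixr 9 _∘_
  infixl 8 _[_]
  field
    Ob    : Set o
    Hom   : Ob → Ob → Set h
    id    : ∀ {n} → Hom n n
    _∘_   : ∀ {l m n} → Hom m n → Hom l m → Hom l n
    idˡ   : ∀ {m n} (f : Hom m n) → id ∘ f ≡ f
    idʳ   : ∀ {m n} (f : Hom m n) → f ∘ id ≡ f
    assoc : ∀ {k l m n} (f : Hom m n) (g : Hom l m) (h : Hom k l) →
            (f ∘ g) ∘ h ≡ f ∘ (g ∘ h)
    ⋄     : Ob
    !     : ∀ n → Hom n ⋄
    !-unique : ∀ {n} (f : Hom n ⋄) → f ≡ ! n
    Tm    : Ob → Set t
    _[_]  : ∀ {m n} → Tm n → Hom m n → Tm m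
    [id]  : ∀ {n} (a : Tm n) → a [ id ] ≡ a
    [∘]   : ∀ {l m n} (a : Tm n) (γ : Hom m n) (δ : Hom l m) →
            a [ γ ∘ δ ] ≡ a [ γ ] [ δ ]
    s     : Ob → Ob
    p     : ∀ {n} → Hom (s n) n
    q     : ∀ {n} → Tm (s n)
    ⟨_,_⟩ : ∀ {m n} → Hom m n → Tm m → Hom m (s n)
    p∘⟨⟩  : ∀ {m n} (γ : Hom m n) (a : Tm m) → p ∘ ⟨ γ , a ⟩ ≡ γ
    q[⟨⟩] : ∀ {m n} (γ : Hom m n) (a : Tm m) → q [ ⟨ γ , a ⟩ ] ≡ a
    ⟨⟩-unique : ∀ {m n} (γ : Hom m n) (a : Tm m) (δ : Hom m (s n)) →
                p ∘ δ ≡ γ → q [ δ ] ≡ a → δ ≡ ⟨ γ , a ⟩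

  s₁ : ∀ {m n} → Hom m n → Hom (s m) (s n)
  s₁ γ = ⟨ γ ∘ p , q ⟩

module _ {o h t : Level} (U : Ucwf o h t) where
  open Ucwf U

  IsNaturalAbs : (∀ {n} → Tm (s n) → Tm n) → Set (o ⊔ h ⊔ t)
  IsNaturalAbs lam = ∀ {m n} (γ : Hom m n) (b : Tm (s n)) →
                     lam b [ γ ] ≡ lam (b [ s₁ γ ])

  IsNaturalAbsInv : (∀ {n} → Tm n → Tm (s n)) → Set (o ⊔ h ⊔ t)
  IsNaturalAbsInv μ = ∀ {m n} (γ : Hom m n) (c : Tm n) →
                      μ c [ s₁ γ ] ≡ μ (c [ γ ])

  IsNatIso : (∀ {n} → Tm (s n) → Tm n) → Set (o ⊔ h ⊔ t)
  IsNatIso lam =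
    IsNaturalAbs lam ×
    Σ (∀ {n} → Tm n → Tm (s n)) (λ μ →
      IsNaturalAbsInv μ ×
      (∀ {n} (c : Tm n) → lam (μ c) ≡ c) ×
      (∀ {n} (b : Tm (s n)) → μ (lam b) ≡ b))

  record LamBetaEta : Set (o ⊔ h ⊔ t) where
    field
      lam   : ∀ {n} → Tm (s n) → Tm n
      ap    : ∀ {n} → Tm n → Tm n → Tm n
      lam-[] : ∀ {m n} (γ : Hom m n) (b : Tm (s n)) →
               lam b [ γ ] ≡ lam (b [ ⟨ γ ∘ p , q ⟩ ])
      ap-[]  : ∀ {m n} (γ : Hom m n) (c a : Tm n) →
               ap c a [ γ ] ≡ ap (c [ γ ]) (a [ γ ])
      β      : ∀ {n} (b : Tm (s n)) (a : Tm n) →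
               ap (lam b) a ≡ b [ ⟨ id , a ⟩ ]
      η      : ∀ {n} (c : Tm n) →
               lam (ap (c [ p ]) q) ≡ c

-- Abstraction and application are interdefinable: in a λβη-structure, η and β say
-- that c ↦ ap (c[p]) q is a natural two-sided inverse of λ, and every application
-- is recovered from it as ap c a = ap (c[p]) q [⟨id, a⟩]. Conversely, from a natural
-- inverse μ of λ one defines ap c a := μ c [⟨id, a⟩]; the formula also forces ap,
-- since two-sided inverses are unique.
module Submission where

open import Defs
open import Level using (Level)
open import Relation.Binary.PropositionalEquality
  using (_≡_; refl; sym; trans; cong; cong₂; module ≡-Reasoning)
open import Data.Product using (Σ; _×_; _,_)

module UcwfProperties {o h t : Level} (U : Ucwf o h t) where
  open Ucwf U
  open ≡-Reasoning

  ⟨p,q⟩≡id : ∀ {n} → ⟨ p , q ⟩ ≡ id {s n}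
  ⟨p,q⟩≡id = sym (⟨⟩-unique p q id (idʳ p) ([id] q))

  ⟨⟩-∘ : ∀ {l m n} (γ : Hom m n) (a : Tm m) (δ : Hom l m) →
         ⟨ γ , a ⟩ ∘ δ ≡ ⟨ γ ∘ δ , a [ δ ] ⟩
  ⟨⟩-∘ γ a δ = ⟨⟩-unique (γ ∘ δ) (a [ δ ]) (⟨ γ , a ⟩ ∘ δ) p-∘ q-[∘]
    where
    p-∘ : p ∘ (⟨ γ , a ⟩ ∘ δ) ≡ γ ∘ δ
    p-∘ = trans (sym (assoc p ⟨ γ , a ⟩ δ)) (cong (_∘ δ) (p∘⟨⟩ γ a))
    q-[∘] : q [ ⟨ γ , a ⟩ ∘ δ ] ≡ a [ δ ]
    q-[∘] = trans ([∘] q ⟨ γ , a ⟩ δ) (cong (_[ δ ]) (q[⟨⟩] γ a))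

  [p][s₁] : ∀ {m n} (c : Tm n) (γ : Hom m n) → c [ p ] [ s₁ γ ] ≡ c [ γ ] [ p ]
  [p][s₁] c γ = begin
    c [ p ] [ s₁ γ ]  ≡⟨ sym ([∘] c p (s₁ γ)) ⟩
    c [ p ∘ s₁ γ ]    ≡⟨ cong (c [_]) (p∘⟨⟩ (γ ∘ p) q) ⟩
    c [ γ ∘ p ]       ≡⟨ [∘] c γ p ⟩
    c [ γ ] [ p ]     ∎

  -- ⟨id, q⟩ : s(n) → s(s(n)) duplicates the last variable; s(p) then forgets one copy.
  s₁p∘⟨id,q⟩≡id : ∀ {n} → s₁ p ∘ ⟨ id , q ⟩ ≡ id {s n}
  s₁p∘⟨id,q⟩≡id = begin
    ⟨ p ∘ p , q ⟩ ∘ ⟨ id , q ⟩                   ≡⟨ ⟨⟩-∘ (p ∘ p) q ⟨ id , q ⟩ ⟩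
    ⟨ (p ∘ p) ∘ ⟨ id , q ⟩ , q [ ⟨ id , q ⟩ ] ⟩  ≡⟨ cong₂ ⟨_,_⟩ p∘p∘⟨id,q⟩ (q[⟨⟩] id q) ⟩
    ⟨ p , q ⟩                                   ≡⟨ ⟨p,q⟩≡id ⟩
    id                                          ∎
    where
    p∘p∘⟨id,q⟩ : (p ∘ p) ∘ ⟨ id , q ⟩ ≡ p
    p∘p∘⟨id,q⟩ = trans (assoc p p ⟨ id , q ⟩)
                       (trans (cong (p ∘_) (p∘⟨⟩ id q)) (idʳ p))

  ⟨id,⟩-natural : ∀ {m n} (γ : Hom m n) (a : Tm n) →
                  ⟨ id , a ⟩ ∘ γ ≡ s₁ γ ∘ ⟨ id , a [ γ ] ⟩
  ⟨id,⟩-natural γ a = begin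
    ⟨ id , a ⟩ ∘ γ                                        ≡⟨ ⟨⟩-∘ id a γ ⟩
    ⟨ id ∘ γ , a [ γ ] ⟩                                  ≡⟨ cong ⟨_, a [ γ ] ⟩ (idˡ γ) ⟩
    ⟨ γ , a [ γ ] ⟩                                       ≡⟨ cong₂ ⟨_,_⟩ (sym γ∘p∘⟨id,a[γ]⟩)
                                                                        (sym (q[⟨⟩] id (a [ γ ]))) ⟩
    ⟨ (γ ∘ p) ∘ ⟨ id , a [ γ ] ⟩ , q [ ⟨ id , a [ γ ] ⟩ ] ⟩ ≡⟨ sym (⟨⟩-∘ (γ ∘ p) q ⟨ id , a [ γ ] ⟩) ⟩
    s₁ γ ∘ ⟨ id , a [ γ ] ⟩                               ∎
    where
    γ∘p∘⟨id,a[γ]⟩ : (γ ∘ p) ∘ ⟨ id , a [ γ ] ⟩ ≡ γ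
    γ∘p∘⟨id,a[γ]⟩ = trans (assoc γ p _) (trans (cong (γ ∘_) (p∘⟨⟩ id (a [ γ ]))) (idʳ γ))

module LamBetaEtaProperties {o h t : Level} {U : Ucwf o h t} (S : LamBetaEta U) where
  open Ucwf U
  open LamBetaEta S
  open UcwfProperties U
  open ≡-Reasoning

  unlam : ∀ {n} → Tm n → Tm (s n)
  unlam c = ap (c [ p ]) q

  unlam-natural : IsNaturalAbsInv U unlam
  unlam-natural γ c = begin
    ap (c [ p ]) q [ s₁ γ ]             ≡⟨ ap-[] (s₁ γ) (c [ p ]) q ⟩
    ap (c [ p ] [ s₁ γ ]) (q [ s₁ γ ])  ≡⟨ cong₂ ap ([p][s₁] c γ) (q[⟨⟩] (γ ∘ p) q) ⟩
    ap (c [ γ ] [ p ]) q                ∎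

  unlam-lam : ∀ {n} (b : Tm (s n)) → unlam (lam b) ≡ b
  unlam-lam b = begin
    ap (lam b [ p ]) q                    ≡⟨ cong (λ x → ap x q) (lam-[] p b) ⟩
    ap (lam (b [ s₁ p ])) q               ≡⟨ β (b [ s₁ p ]) q ⟩
    b [ s₁ p ] [ ⟨ id , q ⟩ ]             ≡⟨ sym ([∘] b (s₁ p) ⟨ id , q ⟩) ⟩
    b [ s₁ p ∘ ⟨ id , q ⟩ ]               ≡⟨ cong (b [_]) s₁p∘⟨id,q⟩≡id ⟩
    b [ id ]                              ≡⟨ [id] b ⟩
    b                                     ∎

  lam-isNatIso : IsNatIso U lam
  lam-isNatIso = lam-[] , unlam , unlam-natural , η , unlam-lam

  ap≡unlam[⟨id,⟩] : ∀ {n} (c a : Tm n) → ap c a ≡ unlam c [ ⟨ id , a ⟩ ]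
  ap≡unlam[⟨id,⟩] c a = begin
    ap c a                      ≡⟨ cong (λ x → ap x a) (sym (η c)) ⟩
    ap (lam (unlam c)) a        ≡⟨ β (unlam c) a ⟩
    unlam c [ ⟨ id , a ⟩ ]      ∎

module FromNatIso {o h t : Level} (U : Ucwf o h t)
                  (lam : ∀ {n} → Ucwf.Tm U (Ucwf.s U n) → Ucwf.Tm U n)
                  (lam-natural : IsNaturalAbs U lam)
                  (unlam : ∀ {n} → Ucwf.Tm U n → Ucwf.Tm U (Ucwf.s U n))
                  (unlam-natural : IsNaturalAbsInv U unlam)
                  (lam-unlam : ∀ {n} (c : Ucwf.Tm U n) → lam (unlam c) ≡ c)
                  (unlam-lam : ∀ {n} (b : Ucwf.Tm U (Ucwf.s U n)) → unlam (lam b) ≡ b)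
                  where
  open Ucwf U
  open UcwfProperties U
  open ≡-Reasoning

  ap : ∀ {n} → Tm n → Tm n → Tm n
  ap c a = unlam c [ ⟨ id , a ⟩ ]

  ap-[] : ∀ {m n} (γ : Hom m n) (c a : Tm n) → ap c a [ γ ] ≡ ap (c [ γ ]) (a [ γ ])
  ap-[] γ c a = begin
    unlam c [ ⟨ id , a ⟩ ] [ γ ]                ≡⟨ sym ([∘] (unlam c) ⟨ id , a ⟩ γ) ⟩
    unlam c [ ⟨ id , a ⟩ ∘ γ ]                  ≡⟨ cong (unlam c [_]) (⟨id,⟩-natural γ a) ⟩
    unlam c [ s₁ γ ∘ ⟨ id , a [ γ ] ⟩ ]         ≡⟨ [∘] (unlam c) (s₁ γ) ⟨ id , a [ γ ] ⟩ ⟩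
    unlam c [ s₁ γ ] [ ⟨ id , a [ γ ] ⟩ ]       ≡⟨ cong (_[ ⟨ id , a [ γ ] ⟩ ]) (unlam-natural γ c) ⟩
    unlam (c [ γ ]) [ ⟨ id , a [ γ ] ⟩ ]        ∎

  η : ∀ {n} (c : Tm n) → lam (ap (c [ p ]) q) ≡ c
  η c = begin
    lam (unlam (c [ p ]) [ ⟨ id , q ⟩ ])       ≡⟨ cong (λ x → lam (x [ ⟨ id , q ⟩ ])) (sym (unlam-natural p c)) ⟩
    lam (unlam c [ s₁ p ] [ ⟨ id , q ⟩ ])      ≡⟨ cong lam (sym ([∘] (unlam c) (s₁ p) ⟨ id , q ⟩)) ⟩
    lam (unlam c [ s₁ p ∘ ⟨ id , q ⟩ ])        ≡⟨ cong (λ x → lam (unlam c [ x ])) s₁p∘⟨id,q⟩≡id ⟩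
    lam (unlam c [ id ])                      ≡⟨ cong lam ([id] (unlam c)) ⟩
    lam (unlam c)                             ≡⟨ lam-unlam c ⟩
    c                                         ∎

  lamBetaEta : LamBetaEta U
  lamBetaEta = record
    { lam = lam
    ; ap = ap
    ; lam-[] = lam-natural
    ; ap-[] = ap-[]
    ; β = λ b a → cong (_[ ⟨ id , a ⟩ ]) (unlam-lam b)
    ; η = η
    }

  ap-unique : (S′ : LamBetaEta U) → (∀ {n} (b : Tm (s n)) → LamBetaEta.lam S′ b ≡ lam b) →
              ∀ {n} (c a : Tm n) → LamBetaEta.ap S′ c a ≡ ap c a
  ap-unique S′ lam′≡lam c a =
    trans (ap≡unlam[⟨id,⟩] c a) (cong (_[ ⟨ id , a ⟩ ]) unlam′≡unlam)
    where
    open LamBetaEta S′ using () renaming (lam to lam′; η to η′)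
    open LamBetaEtaProperties S′ using (ap≡unlam[⟨id,⟩]) renaming (unlam to unlam′)
    unlam′≡unlam : unlam′ c ≡ unlam c
    unlam′≡unlam = begin
      unlam′ c                ≡⟨ sym (unlam-lam (unlam′ c)) ⟩
      unlam (lam (unlam′ c))  ≡⟨ cong unlam (sym (lam′≡lam (unlam′ c))) ⟩
      unlam (lam′ (unlam′ c)) ≡⟨ cong unlam (η′ c) ⟩
      unlam c                 ∎

proposition2 : ∀ {o h t : Level} (U : Ucwf o h t) →
    ((S : LamBetaEta U) → IsNatIso U (LamBetaEta.lam S)) ×
    ((lam : ∀ {n} → Ucwf.Tm U (Ucwf.s U n) → Ucwf.Tm U n) → IsNatIso U lam →
      Σ (LamBetaEta U) (λ S →
        (∀ {n} (b : Ucwf.Tm U (Ucwf.s U n)) → LamBetaEta.lam S b ≡ lam b) ×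
        ((S′ : LamBetaEta U) →
          (∀ {n} (b : Ucwf.Tm U (Ucwf.s U n)) → LamBetaEta.lam S′ b ≡ lam b) →
          ∀ {n} (c a : Ucwf.Tm U n) → LamBetaEta.ap S′ c a ≡ LamBetaEta.ap S c a)))
proposition2 U = LamBetaEtaProperties.lam-isNatIso , λ where
  lam (lam-natural , unlam , unlam-natural , lam-unlam , unlam-lam) →
    let open FromNatIso U lam lam-natural unlam unlam-natural lam-unlam unlam-lam
    in lamBetaEta , (λ b → refl) , ap-unique
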